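{- Let $V$ be a finite set with $|V|$ even. If $v \in \overline{\mathbf N}(PM(V))$ and $v|_K \leq \chi_K$ (componentwise), then $v \in \mathrm{problem}(V)$.
   Context: Let $V$ be a finite set of even size. Let $K=\binom{V}{2}$ be the set of $2$-element subsets of $V$ (edges of the complete graph on $V$), and let $C$ be the set of all partitions $\{A,B\}$ of $V$ into two sets with $|A|=|B|=|V|/2$ ("equal partitions"). For $c=\{A,B\}\in C$ let $B_c$ be the complete bipartite graph with parts $A,B$. Work in $\mathbb{N}^{K\cup C}$ ($\mathbb N$ = nonnegative integers); for a vector $v$, $v|_K$ is its restriction to the coordinates in $K$, and $\chi_K$ is the vector on $K$ with all entries $1$. For a perfect matching $q$ of $B_c$, $\chi_{q,c}\in\mathbb N^{K\cup C}$ has value $1$ on the edges of $q$ and on the coordinate $c$, and $0$ elsewhere. $PM(V)=\{\chi_{q,c} : c\in C,\ q \text{ a perfect matching of } B_c\}$. For $\mathcal M\subset \mathbb N^{K\cup C}$, $\mathbf N(\mathcal M)$ is the set of nonnegative integer combinations of elements of $\mathcal M$, and $\overline{\mathbf N}(\mathcal M)=\{v\in\mathbb N^{K\cup C} : kv\in \mathbf N(\mathcal M) \text{ for some integer } k\ge 1\}$. For $v\in\mathbb N^{K\cup C}$ let $E(v)=\{e\in K: v(e)=1\}$. Define $\mathrm{problem}(V)=\{v\in \mathbb N^{K\cup C} : v|_K\le \chi_K,\ (V,E(v)) \text{ is a regular graph},\ \tfrac{|V|}{2}\sum_{c\in C} v(c)=\sum_{e\in K} v(e)\}$. -}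

module Defs where

open import Data.Bool using (Bool; true; false; T; _∧_; _∨_; _xor_; if_then_else_)
open import Data.Nat using (ℕ; zero; suc; _+_; _*_; _≤_; _≡ᵇ_; _<ᵇ_; _/_)
open import Data.Fin using (Fin; toℕ)
open import Data.Fin.Subset using (Subset; ∣_∣)
open import Data.Vec using (Vec; []; _∷_; lookup)
open import Data.Unit using (tt)
open import Data.List using (List; map)
open import Data.Nat.ListAction using (sum)
open import Data.Product using (Σ; Σ-syntax; ∃; ∃-syntax; _×_; _,_)
open import Data.Sum using (_⊎_; inj₁; inj₂)
open import Relation.Binary.PropositionalEquality using (_≡_)

-- We take V = Fin n.

sumFin : {n : ℕ} → (Fin n → ℕ) → ℕ
sumFin {zero}  f = 0
sumFin {suc n} f = f Fin.zero + sumFin (λ i → f (Fin.suc i))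

sumSub : {n : ℕ} → (Subset n → ℕ) → ℕ
sumSub {zero}  f = f []
sumSub {suc n} f = sumSub (λ s → f (false ∷ s)) + sumSub (λ s → f (true ∷ s))

guardT : (b : Bool) → (T b → ℕ) → ℕ
guardT true  k = k tt
guardT false k = 0

-- K: the edges {i,j} of the complete graph on Fin n, represented as (i , j) with i < j.
Edge : ℕ → Set
Edge n = Σ[ i ∈ Fin n ] Σ[ j ∈ Fin n ] T (toℕ i <ᵇ toℕ j)

edgeSum : {n : ℕ} → (Edge n → ℕ) → ℕ
edgeSum {n} f = sumFin λ i → sumFin λ j → guardT (toℕ i <ᵇ toℕ j) (λ p → f (i , j , p))

-- Equal partitions {A, B} (B = complement of A), represented canonically by the
-- part A containing vertex 0 (for n = 0 the unique partition {∅,∅} is A = ∅).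
anchored : {n : ℕ} → Subset n → Bool
anchored []      = true
anchored (b ∷ _) = b

isEqPart : {n : ℕ} → Subset n → Bool
isEqPart {n} A = ((∣ A ∣ + ∣ A ∣) ≡ᵇ n) ∧ anchored A

Part : ℕ → Set
Part n = Σ[ A ∈ Subset n ] T (isEqPart A)

partSum : {n : ℕ} → (Part n → ℕ) → ℕ
partSum f = sumSub λ A → guardT (isEqPart A) (λ p → f (A , p))

eqSub : {n : ℕ} → Subset n → Subset n → Bool
eqSub []      []      = true
eqSub (a ∷ s) (b ∷ t) = (if a then b else (if b then false else true)) ∧ eqSub s t

-- Coordinates K ∪ C; vectors in ℕ^{K ∪ C} are functions Coord n → ℕ.
Coord : ℕ → Set
Coord n = Edge n ⊎ Part n

incident : {n : ℕ} → Fin n → Edge n → Bool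
incident i (a , b , _) = (toℕ i ≡ᵇ toℕ a) ∨ (toℕ i ≡ᵇ toℕ b)

inBip : {n : ℕ} → Part n → Edge n → Bool
inBip (A , _) (a , b , _) = lookup A a xor lookup A b

IsPerfectMatching : {n : ℕ} → Part n → (Edge n → Bool) → Set
IsPerfectMatching {n} c q =
  (∀ e → T (q e) → T (inBip c e)) ×
  (∀ (i : Fin n) → edgeSum (λ e → if q e ∧ incident i e then 1 else 0) ≡ 1)

PMIndex : ℕ → Set
PMIndex n = Σ[ c ∈ Part n ] Σ[ q ∈ (Edge n → Bool) ] IsPerfectMatching c q

χ : {n : ℕ} → PMIndex n → Coord n → ℕ
χ (c , q , _) (inj₁ e)        = if q e then 1 else 0
χ ((A , _) , q , _) (inj₂ (A' , _)) = if eqSub A A' then 1 else 0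

InN-PM : {n : ℕ} → (Coord n → ℕ) → Set
InN-PM {n} v = Σ[ L ∈ List (PMIndex n) ] (∀ (x : Coord n) → v x ≡ sum (map (λ m → χ m x) L))

InNbar-PM : {n : ℕ} → (Coord n → ℕ) → Set
InNbar-PM {n} v = ∃[ k ] (1 ≤ k × InN-PM (λ x → k * v x))

degE : {n : ℕ} → (Coord n → ℕ) → Fin n → ℕ
degE v i = edgeSum λ e → if incident i e ∧ (v (inj₁ e) ≡ᵇ 1) then 1 else 0

IsRegular : {n : ℕ} → (Coord n → ℕ) → Set
IsRegular {n} v = ∃[ d ] (∀ (i : Fin n) → degE v i ≡ d)

InProblem : {n : ℕ} → (Coord n → ℕ) → Set
InProblem {n} v =
  (∀ (e : Edge n) → v (inj₁ e) ≤ 1) ×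
  IsRegular v ×
  ((n / 2) * partSum (λ c → v (inj₂ c)) ≡ edgeSum (λ e → v (inj₁ e)))

module Submission where

-- Idea: write k·v = χ_{m₁} + … + χ_{m_N}.  Every observation of v that is
-- a linear sum of coordinates (the degree at a vertex i, the total edge
-- weight, the total partition weight) is then k⁻¹ times the sum of the same
-- observation over the χ_m.  For a single χ_{q,c} these observations are
-- constant: every vertex lies on exactly one edge of q, q has |V|/2 edges
-- (handshake lemma), and χ_{q,c} has exactly one partition coordinate.
-- Hence k·deg(i) = N for every vertex i (so E(v) is regular, since v is 0/1
-- on edges), k·Σ_C v = N, and 2·k·Σ_K v = |V|·N, which gives the counting
-- identity (|V|/2)·Σ_C v = Σ_K v.

open import Defs
open import Data.Nat using (ℕ; _≤_)
open import Data.Nat.Divisibility using (_∣_)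
open import Data.Sum using (inj₁)

open import Data.Bool using (Bool; true; false; T; _∧_; if_then_else_)
open import Data.Fin using (Fin; toℕ)
open import Data.Fin.Subset using (Subset)
open import Data.List using (List; []; _∷_; map; length)
open import Data.Nat using (zero; suc; _+_; _*_; _≡ᵇ_; _/_; s≤s; NonZero)
open import Data.Nat.DivMod using (m*n/n≡m)
open import Data.Nat.Divisibility using (divides)
open import Data.Nat.ListAction using (sum)
open import Data.Nat.Properties
open import Algebra.Properties.CommutativeSemigroup +-commutativeSemigroup
  using (interchange)
open import Data.Product using (Σ; _,_)
open import Data.Sum using (inj₂)
open import Data.Vec using ([]; _∷_)
open import Relation.Binary.PropositionalEquality

open ≡-Reasoning

-- A sum operator over A: extensional, vanishing on the zero function and
-- additive.  All sums in the definitions (sumFin, sumSub, edgeSum, partSum)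
-- and sums over lists are of this kind.
record Linear {A : Set} (S : (A → ℕ) → ℕ) : Set where
  field
    ext      : ∀ {f g} → (∀ a → f a ≡ g a) → S f ≡ S g
    vanish   : ∀ {f} → (∀ a → f a ≡ 0) → S f ≡ 0
    additive : ∀ f g → S (λ a → f a + g a) ≡ S f + S g

  scale : ∀ k f → S (λ a → k * f a) ≡ k * S f
  scale zero    f = vanish (λ _ → refl)
  scale (suc k) f = trans (additive f (λ a → k * f a)) (cong (S f +_) (scale k f))

  sum-list-comm : ∀ {B : Set} (L : List B) (h : B → A → ℕ) →
    S (λ a → sum (map (λ m → h m a) L)) ≡ sum (map (λ m → S (h m)) L)
  sum-list-comm []      h = vanish (λ _ → refl)
  sum-list-comm (m ∷ L) h =
    trans (additive (h m) _) (cong (S (h m) +_) (sum-list-comm L h))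

  sumFin-comm : ∀ n (f : A → Fin n → ℕ) →
    S (λ a → sumFin (f a)) ≡ sumFin (λ i → S (λ a → f a i))
  sumFin-comm zero    f = vanish (λ _ → refl)
  sumFin-comm (suc n) f = trans (additive (λ a → f a Fin.zero) _)
    (cong (S (λ a → f a Fin.zero) +_) (sumFin-comm n (λ a i → f a (Fin.suc i))))

open Linear

linear-sumFin : ∀ n → Linear (sumFin {n})
linear-sumFin zero    = record
  { ext = λ _ → refl ; vanish = λ _ → refl ; additive = λ _ _ → refl }
linear-sumFin (suc n) = record
  { ext      = λ f≡g → cong₂ _+_ (f≡g _) (ext rest (λ i → f≡g (Fin.suc i)))
  ; vanish   = λ f≡0 → cong₂ _+_ (f≡0 _) (vanish rest (λ i → f≡0 (Fin.suc i)))
  ; additive = λ f g →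
      trans (cong (f Fin.zero + g Fin.zero +_) (additive rest _ _))
            (interchange (f Fin.zero) (g Fin.zero) _ _)
  }
  where rest = linear-sumFin n

linear-sumSub : ∀ n → Linear (sumSub {n})
linear-sumSub zero    = record
  { ext = λ f≡g → f≡g _ ; vanish = λ f≡0 → f≡0 _ ; additive = λ _ _ → refl }
linear-sumSub (suc n) = record
  { ext      = λ f≡g → cong₂ _+_ (ext rest (λ _ → f≡g _)) (ext rest (λ _ → f≡g _))
  ; vanish   = λ f≡0 → cong₂ _+_ (vanish rest (λ _ → f≡0 _)) (vanish rest (λ _ → f≡0 _))
  ; additive = λ f g →
      trans (cong₂ _+_ (additive rest (λ s → f (false ∷ s)) (λ s → g (false ∷ s)))
                       (additive rest (λ s → f (true ∷ s)) (λ s → g (true ∷ s))))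
            (interchange (sumSub (λ s → f (false ∷ s))) (sumSub (λ s → g (false ∷ s))) _ _)
  }
  where rest = linear-sumSub n

linear-guardT : ∀ b → Linear (guardT b)
linear-guardT true  = record
  { ext = λ f≡g → f≡g _ ; vanish = λ f≡0 → f≡0 _ ; additive = λ _ _ → refl }
linear-guardT false = record
  { ext = λ _ → refl ; vanish = λ _ → refl ; additive = λ _ _ → refl }

linear-list : ∀ {B : Set} (L : List B) → Linear (λ (f : B → ℕ) → sum (map f L))
linear-list []      = record
  { ext = λ _ → refl ; vanish = λ _ → refl ; additive = λ _ _ → refl }
linear-list (m ∷ L) = record
  { ext      = λ f≡g → cong₂ _+_ (f≡g m) (ext rest f≡g)
  ; vanish   = λ f≡0 → cong₂ _+_ (f≡0 m) (vanish rest f≡0)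
  ; additive = λ f g → trans (cong (f m + g m +_) (additive rest f g))
                             (interchange (f m) (g m) _ _)
  }
  where rest = linear-list L

linear-Σ : ∀ {A : Set} {B : A → Set} {S : (A → ℕ) → ℕ} {U : (a : A) → (B a → ℕ) → ℕ} →
  Linear S → (∀ a → Linear (U a)) →
  Linear (λ (f : Σ A B → ℕ) → S (λ a → U a (λ b → f (a , b))))
linear-Σ LS LU = record
  { ext      = λ f≡g → ext LS (λ a → ext (LU a) (λ b → f≡g (a , b)))
  ; vanish   = λ f≡0 → vanish LS (λ a → vanish (LU a) (λ b → f≡0 (a , b)))
  ; additive = λ f g → trans (ext LS (λ a → additive (LU a) _ _)) (additive LS _ _)
  }

linear-edgeSum : ∀ n → Linear (edgeSum {n})
linear-edgeSum n = linear-Σ (linear-sumFin n) (λ _ → linear-Σ (linear-sumFin n) (λ _ → linear-guardT _))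

linear-partSum : ∀ n → Linear (partSum {n})
linear-partSum n = linear-Σ (linear-sumSub n) (λ _ → linear-guardT _)

sum-map-const : ∀ {B : Set} (L : List B) {f : B → ℕ} {c : ℕ} →
  (∀ m → f m ≡ c) → sum (map f L) ≡ c * length L
sum-map-const []      {c = c} _    = sym (*-zeroʳ c)
sum-map-const (m ∷ L) {c = c} f≡c =
  trans (cong₂ _+_ (f≡c m) (sum-map-const L f≡c)) (sym (*-suc c (length L)))

sumFin-one : ∀ n → sumFin {n} (λ _ → 1) ≡ n
sumFin-one zero    = refl
sumFin-one (suc n) = cong suc (sumFin-one n)

point-indicator : ∀ {n} (a : Fin n) → sumFin {n} (λ i → if toℕ i ≡ᵇ toℕ a then 1 else 0) ≡ 1
point-indicator {suc n} Fin.zero    = cong suc (vanish (linear-sumFin n) (λ _ → refl))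
point-indicator {suc n} (Fin.suc a) = point-indicator a

two-endpoints : ∀ {n} (e : Edge n) → sumFin {n} (λ i → if incident i e then 1 else 0) ≡ 2
two-endpoints {suc n} (Fin.zero  , Fin.suc b , _) = cong suc (point-indicator b)
two-endpoints {suc n} (Fin.suc a , Fin.suc b , p) = two-endpoints (a , b , p)

handshake : ∀ n (q : Edge n → Bool) →
  sumFin (λ i → edgeSum (λ e → if q e ∧ incident i e then 1 else 0))
    ≡ 2 * edgeSum (λ e → if q e then 1 else 0)
handshake n q = begin
  sumFin (λ i → edgeSum (λ e → if q e ∧ incident i e then 1 else 0))
    ≡⟨ sym (sumFin-comm (linear-edgeSum n) n _) ⟩
  edgeSum (λ e → sumFin (λ i → if q e ∧ incident i e then 1 else 0))
    ≡⟨ ext (linear-edgeSum n) endpoints ⟩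
  edgeSum (λ e → 2 * (if q e then 1 else 0))
    ≡⟨ scale (linear-edgeSum n) 2 _ ⟩
  2 * edgeSum (λ e → if q e then 1 else 0) ∎
  where
  endpoints : ∀ e → sumFin (λ i → if q e ∧ incident i e then 1 else 0)
                      ≡ 2 * (if q e then 1 else 0)
  endpoints e with q e
  ... | true  = two-endpoints e
  ... | false = vanish (linear-sumFin n) (λ _ → refl)

matching-size : ∀ n (c : Part n) (q : Edge n → Bool) → IsPerfectMatching c q →
  2 * edgeSum (λ e → if q e then 1 else 0) ≡ n
matching-size n c q (_ , covers) = begin
  2 * edgeSum (λ e → if q e then 1 else 0)
    ≡⟨ sym (handshake n q) ⟩
  sumFin (λ i → edgeSum (λ e → if q e ∧ incident i e then 1 else 0))
    ≡⟨ ext (linear-sumFin n) covers ⟩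
  sumFin {n} (λ _ → 1)
    ≡⟨ sumFin-one n ⟩
  n ∎

χ-degree : ∀ {n} (i : Fin n) (m : PMIndex n) →
  edgeSum (λ e → if incident i e then χ m (inj₁ e) else 0) ≡ 1
χ-degree {n} i (c , q , _ , covers) = trans (ext (linear-edgeSum n) reorder) (covers i)
  where
  reorder : ∀ e → (if incident i e then (if q e then 1 else 0) else 0)
                    ≡ (if q e ∧ incident i e then 1 else 0)
  reorder e with incident i e | q e
  ... | true  | true  = refl
  ... | true  | false = refl
  ... | false | true  = refl
  ... | false | false = refl

eqSub-selects : ∀ {n} (A : Subset n) (g : Subset n → ℕ) →
  sumSub (λ s → if eqSub A s then g s else 0) ≡ g A
eqSub-selects             []        g = refl
eqSub-selects {suc n} (true  ∷ A) g =
  cong₂ _+_ (vanish (linear-sumSub n) (λ _ → refl)) (eqSub-selects A (λ s → g (true ∷ s)))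
eqSub-selects {suc n} (false ∷ A) g =
  trans (cong₂ _+_ (eqSub-selects A (λ s → g (false ∷ s))) (vanish (linear-sumSub n) (λ _ → refl)))
        (+-identityʳ _)

χ-partitions : ∀ {n} (m : PMIndex n) → partSum (λ c → χ m (inj₂ c)) ≡ 1
χ-partitions {n} ((A , A-equal) , _) = begin
  sumSub (λ s → guardT (isEqPart s) (λ _ → if eqSub A s then 1 else 0))
    ≡⟨ ext (linear-sumSub n) guard-inside ⟩
  sumSub (λ s → if eqSub A s then guardT (isEqPart s) (λ _ → 1) else 0)
    ≡⟨ eqSub-selects A _ ⟩
  guardT (isEqPart A) (λ _ → 1)
    ≡⟨ guard-holds (isEqPart A) A-equal ⟩
  1 ∎
  where
  guard-holds : ∀ b → T b → guardT b (λ _ → 1) ≡ 1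
  guard-holds true _ = refl
  guard-inside : ∀ s → guardT (isEqPart s) (λ _ → if eqSub A s then 1 else 0)
                         ≡ (if eqSub A s then guardT (isEqPart s) (λ _ → 1) else 0)
  guard-inside s with eqSub A s
  ... | true  = refl
  ... | false = vanish (linear-guardT (isEqPart s)) (λ _ → refl)

zero-one-indicator : ∀ (b : Bool) x → x ≤ 1 →
  (if b ∧ (x ≡ᵇ 1) then 1 else 0) ≡ (if b then x else 0)
zero-one-indicator false x             _ = refl
zero-one-indicator true  zero          _ = refl
zero-one-indicator true  (suc zero)    _ = refl
zero-one-indicator true  (suc (suc x)) (s≤s ())

module Decomposition (n : ℕ) (v : Coord n → ℕ) (k : ℕ) (L : List (PMIndex n))
  (k·v≡ΣL : ∀ x → k * v x ≡ sum (map (λ m → χ m x) L)) where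

  observe : ∀ {A : Set} {S : (A → ℕ) → ℕ} → Linear S → (mask : A → Bool) (w : A → Coord n) →
    k * S (λ a → if mask a then v (w a) else 0)
      ≡ sum (map (λ m → S (λ a → if mask a then χ m (w a) else 0)) L)
  observe {S = S} LS mask w = begin
    k * S (λ a → if mask a then v (w a) else 0)
      ≡⟨ sym (scale LS k _) ⟩
    S (λ a → k * (if mask a then v (w a) else 0))
      ≡⟨ ext LS pointwise ⟩
    S (λ a → sum (map (λ m → if mask a then χ m (w a) else 0) L))
      ≡⟨ sum-list-comm LS L _ ⟩
    sum (map (λ m → S (λ a → if mask a then χ m (w a) else 0)) L) ∎
    where
    pointwise : ∀ a → k * (if mask a then v (w a) else 0)
                        ≡ sum (map (λ m → if mask a then χ m (w a) else 0) L)
    pointwise a with mask a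
    ... | true  = k·v≡ΣL (w a)
    ... | false = trans (*-zeroʳ k) (sym (vanish (linear-list L) (λ _ → refl)))

  degree : (∀ e → v (inj₁ e) ≤ 1) → ∀ i → k * degE v i ≡ length L
  degree v-01 i = begin
    k * degE v i
      ≡⟨ cong (k *_) (ext (linear-edgeSum n) (λ e → zero-one-indicator (incident i e) _ (v-01 e))) ⟩
    k * edgeSum (λ e → if incident i e then v (inj₁ e) else 0)
      ≡⟨ observe (linear-edgeSum n) (incident i) inj₁ ⟩
    sum (map (λ m → edgeSum (λ e → if incident i e then χ m (inj₁ e) else 0)) L)
      ≡⟨ sum-map-const L (χ-degree i) ⟩
    1 * length L
      ≡⟨ *-identityˡ _ ⟩
    length L ∎

  edge-weight : 2 * (k * edgeSum (λ e → v (inj₁ e))) ≡ n * length L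
  edge-weight = begin
    2 * (k * edgeSum (λ e → v (inj₁ e)))
      ≡⟨ cong (2 *_) (observe (linear-edgeSum n) (λ _ → true) inj₁) ⟩
    2 * sum (map (λ m → edgeSum (λ e → χ m (inj₁ e))) L)
      ≡⟨ sym (scale (linear-list L) 2 _) ⟩
    sum (map (λ m → 2 * edgeSum (λ e → χ m (inj₁ e))) L)
      ≡⟨ sum-map-const L (λ { (c , q , pm) → matching-size n c q pm }) ⟩
    n * length L ∎

  partition-weight : k * partSum (λ c → v (inj₂ c)) ≡ length L
  partition-weight = begin
    k * partSum (λ c → v (inj₂ c))
      ≡⟨ observe (linear-partSum n) (λ _ → true) inj₂ ⟩
    sum (map (λ m → partSum (λ c → χ m (inj₂ c))) L)
      ≡⟨ sum-map-const L χ-partitions ⟩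
    1 * length L
      ≡⟨ *-identityˡ _ ⟩
    length L ∎

regular-if-scaled-constant : ∀ {n} (v : Coord n → ℕ) k N .{{_ : NonZero k}} →
  (∀ i → k * degE v i ≡ N) → IsRegular v
regular-if-scaled-constant v k N k·deg≡N = N / k , λ i → begin
  degE v i         ≡⟨ sym (m*n/n≡m (degE v i) k) ⟩
  degE v i * k / k ≡⟨ cong (_/ k) (trans (*-comm (degE v i) k) (k·deg≡N i)) ⟩
  N / k            ∎

half-count : ∀ h k P E N .{{_ : NonZero k}} →
  k * P ≡ N → 2 * (k * E) ≡ h * 2 * N → h * 2 / 2 * P ≡ E
half-count h k P E N k·P≡N 2kE≡2hN = *-cancelˡ-≡ _ _ k (begin
  k * (h * 2 / 2 * P) ≡⟨ cong (λ x → k * (x * P)) (m*n/n≡m h 2) ⟩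
  k * (h * P)         ≡⟨ sym (*-assoc k h P) ⟩
  k * h * P           ≡⟨ cong (_* P) (*-comm k h) ⟩
  h * k * P           ≡⟨ *-assoc h k P ⟩
  h * (k * P)         ≡⟨ cong (h *_) k·P≡N ⟩
  h * N               ≡⟨ sym k·E≡hN ⟩
  k * E               ∎)
  where
  k·E≡hN : k * E ≡ h * N
  k·E≡hN = *-cancelˡ-≡ _ _ 2
    (trans 2kE≡2hN (trans (cong (_* N) (*-comm h 2)) (*-assoc 2 h N)))

proposition1 : (n : ℕ) → 2 ∣ n → (v : Coord n → ℕ) →
    InNbar-PM v → (∀ (e : Edge n) → v (inj₁ e) ≤ 1) → InProblem v
proposition1 .(h * 2) (divides h refl) v (suc k , _ , L , k·v≡ΣL) v-01 =
    v-01
  , regular-if-scaled-constant v (suc k) (length L) (degree v-01)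
  , half-count h (suc k) _ _ (length L) partition-weight edge-weight
  where open Decomposition (h * 2) v (suc k) L k·v≡ΣL
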